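{- Let $\phi := \Pi.\psi$ be a QBF in prenex CNF and let $C \in \psi$ be a clause. Let $\psi' := \psi \setminus \{C\}$ and $\phi' := \Pi.\psi'$. Suppose $C$ has property $\mathsf{QIOR}^{+}$ on an existential literal $l \in C$ with respect to $\phi'$. Then $\phi \equiv_{\mathit{sat}} \phi'$, i.e., $\phi$ is satisfiable if and only if $\phi'$ is satisfiable.
   Context: A QBF in prenex CNF is $\phi = \Pi.\psi$ with prefix $\Pi = Q_1B_1\ldots Q_nB_n$, where the $B_i$ are pairwise disjoint finite sets of propositional variables, $Q_i \in \{\forall,\exists\}$, $Q_i \neq Q_{i+1}$, $Q_n = \exists$, and $\psi$ is a CNF (a set of non-tautological clauses) over variables of $B_1\cup\dots\cup B_n$ (here the prefix of $\phi'$ may contain variables no longer occurring in $\psi'$; they remain quantified as in $\Pi$). For a literal $l$ with variable $\mathrm{var}(l) \in B_i$, its quantifier is $Q_i$, and $l$ is existential if $Q_i=\exists$, universal if $Q_i=\forall$. The order $\leq_\Pi$: for literals $l,k$ with variables in $B_i$, $B_j$, $l \leq_\Pi k$ iff $i \leq j$, refined by an arbitrary but fixed total order on the variables inside each block (so $\leq_\Pi$ is a total order on variables). Semantics: the assignment tree of $\phi$ is a complete binary tree whose internal nodes at each depth are associated with the variables in the order $\leq_\Pi$; each internal node for variable $x$ has two children reached by edges labelled $\bar x$ and $x$ (assigning $x$ false/true). Each root-to-leaf path $\tau$ is a complete assignment (identified with a set of literals); the leaf is labelled $\top$ iff $\tau$ satisfies $\psi$; an internal existential (universal) node is labelled $\top$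 iff one (both) of its children is (are) labelled $\top$. A pre-model is a subtree $T'$ containing the root such that each universal internal node in $T'$ has both children in $T'$ and each existential internal node in $T'$ has exactly one child in $T'$. A model of $\phi$ is a pre-model all of whose nodes are labelled $\top$ (equivalently, every root-to-leaf path of it satisfies $\psi$). $\phi$ is satisfiable iff it has a model. Outer clause: $\mathsf{OC}(\Pi,D,k) := \{k' \in D \mid k' \leq_\Pi k, k' \neq k\}$. Outer resolvent of $C$ (with $l\in C$) with $D$ (with $\bar l \in D$): $\mathsf{OR}(\Pi,C,D,l) := (C\setminus\{l\}) \cup \mathsf{OC}(\Pi,D,\bar l)$. For QBFs $\Pi.\chi$ and $\Pi.\chi'$ with the same prefix, $\Pi.\chi \equiv_t \Pi.\chi'$ means that for every tree $T$, $T$ is a model of $\Pi.\chi$ iff $T$ is a model of $\Pi.\chi'$. A clause $C$ has property $\mathsf{QIOR}^{+}$ on literal $l \in C$ with respect to QBF $\Pi.\chi$ iff $\Pi.\chi \equiv_t \Pi.(\chi \wedge \mathsf{OR}(\Pi,C,D,l))$ for all $D \in \chi$ with $\bar l \in D$. -}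

module Defs where

open import Data.Nat using (ℕ; zero; suc; _≤_; _≤?_; _≡ᵇ_)
open import Data.Bool using (Bool; true; false; not; if_then_else_)
open import Data.Product using (Σ; ∃; _×_; _,_; proj₁; proj₂)
open import Data.Product.Properties using (≡-dec)
open import Data.Maybe using (Maybe; just; nothing)
open import Data.List using (List; []; _∷_; _++_; map; concatMap; filter)
open import Data.List.Relation.Unary.All using (All)
open import Data.List.Relation.Unary.Any using (Any)
import Data.List.Relation.Unary.All as All
import Data.List.Relation.Unary.Any as Any
open import Data.List.Membership.Propositional using (_∈_; _∉_)
open import Data.List.Relation.Unary.Unique.Propositional using (Unique)
open import Data.Unit using (⊤)
open import Relation.Binary.PropositionalEquality using (_≡_; _≢_)
open import Relation.Nullary using (¬_; Dec; yes; no)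
open import Relation.Nullary.Decidable using (_×-dec_; ¬?)
open import Function.Bundles using (_⇔_)
import Data.Nat as ℕ
import Data.Bool as 𝔹

Var : Set
Var = ℕ

-- a literal is a variable with a polarity (true = positive literal x,
-- false = negative literal x̄)
Lit : Set
Lit = Var × Bool

var : Lit → Var
var = proj₁

neg : Lit → Lit
neg (x , b) = (x , not b)

_≟L_ : (k k' : Lit) → Dec (k ≡ k')
_≟L_ = ≡-dec ℕ._≟_ 𝔹._≟_

-- clauses are finite sets of literals, represented by lists
-- (only membership matters)
Clause : Set
Clause = List Lit

CNF : Set
CNF = List Clause

_⊆?_ : (C D : Clause) → Dec (All (λ k → Any (k ≡_) D) C)
C ⊆? D = All.all? (λ k → Any.any? (k ≟L_) D) C

SameClause? : (C D : Clause) → Dec ((All (λ k → Any (k ≡_) D) C) × (All (λ k → Any (k ≡_) C) D))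
SameClause? C D = (C ⊆? D) ×-dec (D ⊆? C)

-- ψ ∖ {C} : remove (every representative of) the clause C
removeClause : CNF → Clause → CNF
removeClause ψ C = filter (λ D → ¬? (SameClause? D C)) ψ

data Quant : Set where
  ∀q ∃q : Quant

-- a block Q B: a quantifier and the block's variables, listed in the
-- fixed total order chosen inside the block
Block : Set
Block = Quant × List Var

Prefix : Set
Prefix = List Block

-- the variables of Π in the order ≤_Π, each with its quantifier
flat : Prefix → List (Quant × Var)
flat = concatMap (λ b → map (λ x → (proj₁ b , x)) (proj₂ b))

vars : Prefix → List Var
vars Π = map proj₂ (flat Π)

Alternating : Prefix → Set
Alternating [] = ⊤
Alternating (b ∷ []) = ⊤
Alternating (b ∷ b' ∷ bs) = (proj₁ b ≢ proj₁ b') × Alternating (b' ∷ bs)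

lastQuant : Prefix → Maybe Quant
lastQuant [] = nothing
lastQuant (b ∷ []) = just (proj₁ b)
lastQuant (b ∷ b' ∷ bs) = lastQuant (b' ∷ bs)

WFPrefix : Prefix → Set
WFPrefix Π = Alternating Π × (lastQuant Π ≡ just ∃q) × Unique (vars Π)

NonTautological : Clause → Set
NonTautological C = ∀ k → k ∈ C → neg k ∉ C

WFQBF : Prefix → CNF → Set
WFQBF Π ψ = WFPrefix Π
          × All NonTautological ψ
          × All (All (λ k → var k ∈ vars Π)) ψ

quantOf : List (Quant × Var) → Var → Maybe Quant
quantOf [] x = nothing
quantOf ((q , y) ∷ vs) x = if x ≡ᵇ y then just q else quantOf vs x

Existential : Prefix → Lit → Set
Existential Π l = quantOf (flat Π) (var l) ≡ just ∃q

position : List (Quant × Var) → Var → ℕ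
position [] x = zero
position ((q , y) ∷ vs) x = if x ≡ᵇ y then zero else suc (position vs x)

_≤[_]_ : Lit → Prefix → Lit → Set
k' ≤[ Π ] k = position (flat Π) (var k') ≤ position (flat Π) (var k)

_≤[_]?_ : (k' : Lit) (Π : Prefix) (k : Lit) → Dec (k' ≤[ Π ] k)
k' ≤[ Π ]? k = position (flat Π) (var k') ≤? position (flat Π) (var k)

OC : Prefix → Clause → Lit → Clause
OC Π D k = filter (λ k' → (k' ≤[ Π ]? k) ×-dec ¬? (k' ≟L k)) D

OR : Prefix → Clause → Clause → Lit → Clause
OR Π C D l = filter (λ k → ¬? (k ≟L l)) C ++ OC Π D (neg l)

-- A pre-model (a subtree of the complete assignment tree over the
-- variables in order ≤_Π containing the root): at a universal node both
-- children (edge x̄ then edge x) are present, at an existential node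
-- exactly one child, selected by the chosen value of x.
data PreModel : List (Quant × Var) → Set where
  leaf  : PreModel []
  ∀node : ∀ {x vs} → PreModel vs → PreModel vs → PreModel ((∀q , x) ∷ vs)
  ∃node : ∀ {x vs} → Bool → PreModel vs → PreModel ((∃q , x) ∷ vs)

SatClause : List Lit → Clause → Set
SatClause τ C = Any (λ k → k ∈ τ) C

SatCNF : List Lit → CNF → Set
SatCNF τ ψ = All (SatClause τ) ψ

AllPathsSat : ∀ {vs} → List Lit → PreModel vs → CNF → Set
AllPathsSat τ leaf χ = SatCNF τ χ
AllPathsSat {(_ , x) ∷ _} τ (∀node t₀ t₁) χ =
  AllPathsSat ((x , false) ∷ τ) t₀ χ × AllPathsSat ((x , true) ∷ τ) t₁ χ
AllPathsSat {(_ , x) ∷ _} τ (∃node b t) χ = AllPathsSat ((x , b) ∷ τ) t χ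

IsModel : (Π : Prefix) → PreModel (flat Π) → CNF → Set
IsModel Π T χ = AllPathsSat [] T χ

Satisfiable : Prefix → CNF → Set
Satisfiable Π χ = Σ (PreModel (flat Π)) (λ T → IsModel Π T χ)

_≡t[_]_ : CNF → Prefix → CNF → Set
χ ≡t[ Π ] χ' = (T : PreModel (flat Π)) → IsModel Π T χ ⇔ IsModel Π T χ'

QIOR⁺ : Prefix → CNF → Clause → Lit → Set
QIOR⁺ Π χ C l = (D : Clause) → D ∈ χ → neg l ∈ D →
  χ ≡t[ Π ] (OR Π C D l ∷ χ)

-- Dropping C only weakens ψ, so the real content is that a model T of ψ′ yields a
-- model of ψ′ ∧ C.  By QIOR⁺, T is also a model of every outer resolvent
-- OR(C, D, l).  Change T only at the existential nodes of var l below which some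
-- path falsifies C, choosing l there.  A clause D ∈ ψ′ could then only lose its
-- satisfying literal l̄; but on the falsifying path the resolvent OR(C, D, l)
-- holds while C ∖ {l} fails, so some literal of D outer to l̄ is true on it, and
-- that literal lies on the common part of all paths through the node.
module Submission where

open import Defs
open import Data.List.Membership.Propositional using (_∈_)
open import Function.Bundles using (_⇔_)

open import Data.Bool using (Bool; true; false; not)
open import Data.Bool.Properties using (¬-not)
open import Data.Empty using (⊥-elim)
open import Data.List using (List; []; _∷_; _++_; _∷ʳ_; map; filter)
open import Data.List.Properties using (∷ʳ-++)
open import Data.List.Membership.Propositional using (find; lose)
open import Data.List.Membership.Propositional.Properties
  using (∈-++⁺ˡ; ∈-++⁺ʳ; ∈-++⁻; ∈-filter⁺; ∈-filter⁻)
open import Data.List.Membership.DecPropositional _≟L_ using (_∈?_)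
open import Data.List.Relation.Unary.All using (All; []; _∷_)
import Data.List.Relation.Unary.All as All
open import Data.List.Relation.Unary.All.Properties using (∷ʳ⁺; filter⁺)
open import Data.List.Relation.Unary.AllPairs using (_∷_)
open import Data.List.Relation.Unary.Any using (here; there)
import Data.List.Relation.Unary.Any as Any
open import Data.List.Relation.Unary.Unique.Propositional using (Unique)
open import Data.Maybe using (just)
open import Data.Nat using (suc; _<_; _≟_; s≤s; z≤n)
open import Data.Nat.Properties using (<⇒≱)
open import Data.Product using (Σ; ∃; _×_; _,_; proj₁; proj₂)
open import Data.Sum using (_⊎_; inj₁; inj₂)
open import Function using (_∘_)
open import Function.Bundles using (mk⇔; Equivalence)
open import Relation.Binary.PropositionalEquality
  using (_≡_; _≢_; refl; sym; trans; subst; ≢-sym)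
open import Relation.Nullary using (¬_; Dec; yes; no; contradiction)
open import Relation.Nullary.Decidable using (dec-true; dec-false; _×-dec_; ¬?)

-- `does (y ≟ x)` is definitionally `y ≡ᵇ x`, the test performed by quantOf and position.
quantOf-here : ∀ q x vs → quantOf ((q , x) ∷ vs) x ≡ just q
quantOf-here q x vs rewrite dec-true (x ≟ x) refl = refl

quantOf-there : ∀ {q x y} vs → x ≢ y → quantOf ((q , x) ∷ vs) y ≡ quantOf vs y
quantOf-there {x = x} {y} vs x≢y rewrite dec-false (y ≟ x) (≢-sym x≢y) = refl

position-here : ∀ q x vs → position ((q , x) ∷ vs) x ≡ 0
position-here q x vs rewrite dec-true (x ≟ x) refl = refl

position-there : ∀ {q x y} vs → x ≢ y → position ((q , x) ∷ vs) y ≡ suc (position vs y)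
position-there {x = x} {y} vs x≢y rewrite dec-false (y ≟ x) (≢-sym x≢y) = refl

∈-vars-++⁺ʳ : ∀ (pre : List (Quant × Var)) {vs y} → y ∈ map proj₂ vs → y ∈ map proj₂ (pre ++ vs)
∈-vars-++⁺ʳ []        y∈ = y∈
∈-vars-++⁺ʳ (_ ∷ pre) y∈ = there (∈-vars-++⁺ʳ pre y∈)

position-< : ∀ (pre : List (Quant × Var)) {q x vs y} →
  Unique (map proj₂ (pre ++ (q , x) ∷ vs)) → y ∈ map proj₂ vs →
  position (pre ++ (q , x) ∷ vs) x < position (pre ++ (q , x) ∷ vs) y
position-< [] {q} {x} {vs} (x∉vs ∷ _) y∈vs
  rewrite position-here q x vs | position-there {q} vs (All.lookup x∉vs y∈vs) = s≤s z≤n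
position-< ((q′ , z) ∷ pre) {q} {x} {vs} (z∉ ∷ uniq) y∈vs
  rewrite position-there {q′} (pre ++ (q , x) ∷ vs) (All.lookup z∉ (∈-vars-++⁺ʳ pre (here refl)))
        | position-there {q′} (pre ++ (q , x) ∷ vs) (All.lookup z∉ (∈-vars-++⁺ʳ pre (there y∈vs)))
  = s≤s (position-< pre uniq y∈vs)

-- Path τ t σ: σ is the complete assignment at a leaf of t when τ is the
-- assignment at the root of t (literals are pushed in front, as in AllPathsSat).
data Path : ∀ {vs} → List Lit → PreModel vs → List Lit → Set where
  leaf   : ∀ {τ} → Path τ leaf τ
  left   : ∀ {x vs τ σ} {t₀ t₁ : PreModel vs} →
           Path ((x , false) ∷ τ) t₀ σ → Path τ (∀node {x = x} t₀ t₁) σ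
  right  : ∀ {x vs τ σ} {t₀ t₁ : PreModel vs} →
           Path ((x , true) ∷ τ) t₁ σ → Path τ (∀node {x = x} t₀ t₁) σ
  chosen : ∀ {x vs τ σ b} {t : PreModel vs} →
           Path ((x , b) ∷ τ) t σ → Path τ (∃node {x = x} b t) σ

OnAllPaths : ∀ {vs} → (List Lit → Set) → List Lit → PreModel vs → Set
OnAllPaths P τ t = ∀ {σ} → Path τ t σ → P σ

allPathsSat⁻ : ∀ {vs τ χ} {t : PreModel vs} → AllPathsSat τ t χ → OnAllPaths (λ σ → SatCNF σ χ) τ t
allPathsSat⁻ sat       leaf       = sat
allPathsSat⁻ (sat , _) (left p)   = allPathsSat⁻ sat p
allPathsSat⁻ (_ , sat) (right p)  = allPathsSat⁻ sat p
allPathsSat⁻ sat       (chosen p) = allPathsSat⁻ sat p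

allPathsSat⁺ : ∀ {vs τ χ} (t : PreModel vs) → OnAllPaths (λ σ → SatCNF σ χ) τ t → AllPathsSat τ t χ
allPathsSat⁺ leaf          sat = sat leaf
allPathsSat⁺ (∀node t₀ t₁) sat = allPathsSat⁺ t₀ (sat ∘ left) , allPathsSat⁺ t₁ (sat ∘ right)
allPathsSat⁺ (∃node b t)   sat = allPathsSat⁺ t (sat ∘ chosen)

satisfiable-mono : ∀ {Π χ χ′} → (∀ {σ} → SatCNF σ χ → SatCNF σ χ′) →
  Satisfiable Π χ → Satisfiable Π χ′
satisfiable-mono f (T , model) = T , allPathsSat⁺ T (f ∘ allPathsSat⁻ model)

onAllPaths-or-counterexample : ∀ {P : List Lit → Set} → (∀ σ → Dec (P σ)) →
  ∀ {vs} τ (t : PreModel vs) → OnAllPaths P τ t ⊎ ∃ λ σ → Path τ t σ × ¬ P σ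
onAllPaths-or-counterexample P? τ leaf with P? τ
... | yes p = inj₁ λ { leaf → p }
... | no ¬p = inj₂ (τ , leaf , ¬p)
onAllPaths-or-counterexample P? τ (∀node t₀ t₁)
  with onAllPaths-or-counterexample P? _ t₀ | onAllPaths-or-counterexample P? _ t₁
... | inj₂ (σ , p , ¬p) | _                 = inj₂ (σ , left p , ¬p)
... | inj₁ _            | inj₂ (σ , p , ¬p) = inj₂ (σ , right p , ¬p)
... | inj₁ all₀         | inj₁ all₁         = inj₁ λ { (left p) → all₀ p ; (right p) → all₁ p }
onAllPaths-or-counterexample P? τ (∃node b t) with onAllPaths-or-counterexample P? _ t
... | inj₁ all            = inj₁ λ { (chosen p) → all p }
... | inj₂ (σ , p , ¬p)   = inj₂ (σ , chosen p , ¬p)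

Split : ∀ {vs} → List Lit → PreModel vs → List Lit → Set
Split {vs} τ t σ =
  ∃ λ ρ → σ ≡ ρ ++ τ × All (λ k → var k ∈ map proj₂ vs) ρ × (∀ τ′ → Path τ′ t (ρ ++ τ′))

split-∷ : ∀ {q x b vs τ σ} {t : PreModel vs} {t′ : PreModel ((q , x) ∷ vs)} →
  (∀ {τ′ σ′} → Path ((x , b) ∷ τ′) t σ′ → Path τ′ t′ σ′) →
  Split ((x , b) ∷ τ) t σ → Split τ t′ σ
split-∷ {x = x} {b} {τ = τ} step (ρ , refl , ρ-vars , reroot) =
  ρ ∷ʳ (x , b) , sym (∷ʳ-++ ρ _ τ) , ∷ʳ⁺ (All.map there ρ-vars) (here refl) ,
  λ τ′ → subst (Path τ′ _) (sym (∷ʳ-++ ρ _ τ′)) (step (reroot _))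

path-split : ∀ {vs τ σ} {t : PreModel vs} → Path τ t σ → Split τ t σ
path-split leaf       = [] , refl , [] , λ _ → leaf
path-split (left p)   = split-∷ left (path-split p)
path-split (right p)  = split-∷ right (path-split p)
path-split (chosen p) = split-∷ chosen (path-split p)

satClause? : ∀ σ C → Dec (SatClause σ C)
satClause? σ C = Any.any? (_∈? σ) C

satClause-⊆ : ∀ {σ C D} → All (_∈ D) C → SatClause σ C → SatClause σ D
satClause-⊆ C⊆D sat with find sat
... | k , k∈C , k∈σ = lose (All.lookup C⊆D k∈C) k∈σ

satCNF-removeClause⁻ : ∀ {σ} ψ C → SatCNF σ (C ∷ removeClause ψ C) → SatCNF σ ψ
satCNF-removeClause⁻ ψ C (satC ∷ sat) = All.tabulate satE
  where
  satE : ∀ {E} → E ∈ ψ → SatClause _ E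
  satE {E} E∈ψ with SameClause? E C
  ... | yes (_ , C⊆E) = satClause-⊆ C⊆E satC
  ... | no  E≉C       = All.lookup sat (∈-filter⁺ (λ D → ¬? (SameClause? D C)) E∈ψ E≉C)

satClause-replace : ∀ ρ {k k′ τ D} → SatClause (ρ ++ k ∷ τ) D → (k ∈ D → SatClause τ D) →
  SatClause (ρ ++ k′ ∷ τ) D
satClause-replace ρ sat outer with find sat
... | j , j∈D , j∈σ with ∈-++⁻ ρ j∈σ
...   | inj₁ j∈ρ         = lose j∈D (∈-++⁺ˡ j∈ρ)
...   | inj₂ (here refl) = Any.map (∈-++⁺ʳ ρ ∘ there) (outer j∈D)
...   | inj₂ (there j∈τ) = lose j∈D (∈-++⁺ʳ ρ (there j∈τ))

resolvent⇒satClause-outer : ∀ Π {C D l ρ τ} → All (λ k → ¬ (k ≤[ Π ] neg l)) ρ →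
  ¬ SatClause (ρ ++ neg l ∷ τ) C → SatClause (ρ ++ neg l ∷ τ) (OR Π C D l) → SatClause τ D
resolvent⇒satClause-outer Π {C} {D} {l} {ρ} inner ¬satC sat with find sat
... | k , k∈OR , k∈σ with ∈-++⁻ (filter (λ k → ¬? (k ≟L l)) C) k∈OR
...   | inj₁ k∈C∖l = ⊥-elim (¬satC (lose (proj₁ (∈-filter⁻ _ k∈C∖l)) k∈σ))
...   | inj₂ k∈OC with ∈-filter⁻ (λ k → (k ≤[ Π ]? neg l) ×-dec ¬? (k ≟L neg l)) {xs = D} k∈OC
...     | k∈D , k≤l̄ , k≢l̄ with ∈-++⁻ ρ k∈σ
...       | inj₁ k∈ρ         = ⊥-elim (All.lookup inner k∈ρ k≤l̄)
...       | inj₂ (here k≡l̄)  = ⊥-elim (k≢l̄ k≡l̄)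
...       | inj₂ (there k∈τ) = lose k∈D k∈τ

module Repair (Π : Prefix) (C : Clause) (ψ′ : CNF) (l : Lit)
              (uniq : Unique (vars Π)) (l∈C : l ∈ C) where

  SatWithResolvents : List Lit → Set
  SatWithResolvents σ = SatCNF σ ψ′ × (∀ D → D ∈ ψ′ → neg l ∈ D → SatClause σ (OR Π C D l))

  -- vs is a suffix of the ordered prefix in which var l still occurs, existentially
  Pending : List (Quant × Var) → Set
  Pending vs = (∃ λ pre → pre ++ vs ≡ flat Π) × quantOf vs (var l) ≡ just ∃q

  pending-∷ : ∀ {q x vs} → x ≢ var l → Pending ((q , x) ∷ vs) → Pending vs
  pending-∷ {q} {x} {vs} x≢l ((pre , eq) , ∃l) =
    (pre ∷ʳ (q , x) , trans (∷ʳ-++ pre _ vs) eq) , trans (sym (quantOf-there vs x≢l)) ∃l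

  pending-inner : ∀ {q ws} → Pending ((q , var l) ∷ ws) →
    ∀ k → var k ∈ map proj₂ ws → ¬ (k ≤[ Π ] neg l)
  pending-inner ((pre , eq) , _) k k∈ws =
    <⇒≱ (subst (λ L → position L (var l) < position L (var k)) eq
              (position-< pre (subst (Unique ∘ map proj₂) (sym eq) uniq) k∈ws))

  falsified⇒¬l : ∀ ρ {τ b} → ¬ SatClause (ρ ++ (var l , b) ∷ τ) C → b ≡ not (proj₂ l)
  falsified⇒¬l ρ ¬satC = ¬-not λ { refl → ¬satC (lose l∈C (∈-++⁺ʳ ρ (here refl))) }

  repairAt : ∀ {ws} → (∀ k → var k ∈ map proj₂ ws → ¬ (k ≤[ Π ] neg l)) →
    ∀ τ b (t : PreModel ws) → OnAllPaths SatWithResolvents ((var l , b) ∷ τ) t →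
    Σ Bool λ b′ → OnAllPaths (λ σ → SatCNF σ (C ∷ ψ′)) ((var l , b′) ∷ τ) t
  repairAt inner τ b t sat with onAllPaths-or-counterexample (λ σ → satClause? σ C) _ t
  ... | inj₁ satC = b , λ p → satC p ∷ proj₁ (sat p)
  ... | inj₂ (σ₀ , p₀ , ¬satC₀) with path-split p₀
  ...   | ρ₀ , refl , ρ₀-vars , _ with falsified⇒¬l ρ₀ ¬satC₀
  ...     | refl = proj₂ l , sat-l
    where
    outer : ∀ {D} → D ∈ ψ′ → neg l ∈ D → SatClause τ D
    outer D∈ψ′ l̄∈D = resolvent⇒satClause-outer Π {l = l}
      (All.map (λ {k} → inner k) ρ₀-vars) ¬satC₀ (proj₂ (sat p₀) _ D∈ψ′ l̄∈D)

    sat-l : OnAllPaths (λ σ → SatCNF σ (C ∷ ψ′)) (l ∷ τ) t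
    sat-l p with path-split p
    ... | ρ , refl , _ , reroot =
      lose l∈C (∈-++⁺ʳ ρ (here refl)) ∷
      All.tabulate λ D∈ψ′ →
        satClause-replace ρ (All.lookup (proj₁ (sat (reroot _))) D∈ψ′) (outer D∈ψ′)

  repair : ∀ {vs} → Pending vs → ∀ τ (t : PreModel vs) → OnAllPaths SatWithResolvents τ t →
    Σ (PreModel vs) (OnAllPaths (λ σ → SatCNF σ (C ∷ ψ′)) τ)
  repair (_ , ()) τ leaf sat
  repair {(∀q , x) ∷ vs} pend τ (∀node t₀ t₁) sat with x ≟ var l
  ... | yes refl = contradiction (trans (sym (quantOf-here ∀q x vs)) (proj₂ pend)) λ ()
  ... | no x≢l with repair (pending-∷ x≢l pend) _ t₀ (sat ∘ left)
                  | repair (pending-∷ x≢l pend) _ t₁ (sat ∘ right)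
  ...   | t₀′ , sat₀ | t₁′ , sat₁ = ∀node t₀′ t₁′ , λ { (left p) → sat₀ p ; (right p) → sat₁ p }
  repair {(∃q , x) ∷ vs} pend τ (∃node b t) sat with x ≟ var l
  ... | yes refl with repairAt (pending-inner pend) τ b t (sat ∘ chosen)
  ...   | b′ , sat′ = ∃node b′ t , λ { (chosen p) → sat′ p }
  repair {(∃q , x) ∷ vs} pend τ (∃node b t) sat
      | no x≢l with repair (pending-∷ x≢l pend) _ t (sat ∘ chosen)
  ...   | t′ , sat′ = ∃node b t′ , λ { (chosen p) → sat′ p }

qior⁺⇒satisfiable-∷ : ∀ Π ψ′ C l → Unique (vars Π) → Existential Π l → l ∈ C →
  QIOR⁺ Π ψ′ C l → Satisfiable Π ψ′ → Satisfiable Π (C ∷ ψ′)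
qior⁺⇒satisfiable-∷ Π ψ′ C l uniq ∃l l∈C qior (T , model)
  with repair (([] , refl) , ∃l) [] T satWithResolvents
  where
  open Repair Π C ψ′ l uniq l∈C
  satWithResolvents : OnAllPaths SatWithResolvents [] T
  satWithResolvents p = allPathsSat⁻ model p , λ D D∈ψ′ l̄∈D →
    All.head (allPathsSat⁻ (Equivalence.to (qior D D∈ψ′ l̄∈D T) model) p)
... | T′ , sat = T′ , allPathsSat⁺ T′ sat

theorem3 : (Π : Prefix) (ψ : CNF) (C : Clause) (l : Lit) →
    WFQBF Π ψ → C ∈ ψ → l ∈ C → Existential Π l →
    QIOR⁺ Π (removeClause ψ C) C l →
    Satisfiable Π ψ ⇔ Satisfiable Π (removeClause ψ C)
theorem3 Π ψ C l ((_ , _ , uniq) , _ , _) _ l∈C ∃l qior =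
  mk⇔ (satisfiable-mono {Π} (filter⁺ _))
      (satisfiable-mono {Π} (satCNF-removeClause⁻ ψ C) ∘
       qior⁺⇒satisfiable-∷ Π _ C l uniq ∃l l∈C qior)
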